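{- Let $G=(V,\mathcal D,\ell_v)$ be a finite node-labeled digraph that is weakly connected, simple and oriented, and suppose $G$ has a subgraph $H=(U,W,\ell_v|_U)$ (with $W\subseteq\mathcal D$) such that $S(H)\cong Y$. Let $G'=(V',\mathcal D',\ell'_v)$ be a finite node-labeled digraph that is weakly connected, simple and oriented, and let $\phi:\mathcal D\to\mathcal D'$ be an isomorphism between the extended line digraphs $\mathcal L(G)$ and $\mathcal L(G')$. Then the edge-induced subgraph $H'$ of $G'$ induced by the edge set $\phi(W)$ satisfies $S(H')\cong Y$.
   Context: A node-labeled digraph $G=(V,\mathcal D,\ell_v)$ consists of a finite node set $V$, directed edges $\mathcal D\subseteq V\times V$, and a node-labeling function $\ell_v$. Weakly connected: underlying undirected graph connected. Simple: no self-loops and no parallel edges with the same source and target. Oriented: no pair $(u,v),(v,u)$ both in $\mathcal D$. A subgraph $(U,W,\ell_v|_U)$ has $U\subseteq V$, $W\subseteq\mathcal D$ with all endpoints of edges of $W$ in $U$. For $W'\subseteq\mathcal D'$, the $W'$ edge-induced subgraph of $G'$ has as nodes the endpoints of edges in $W'$ and edge set $W'$. The structure $S(K)$ of a digraph $K$ is the unlabeled undirected graph on its nodes with edges $\{u,v\}$ for each directed edge $(u,v)$. $Y$ is the undirected graph with nodes $a,b,c,d$ and edges $\{a,b\},\{a,c\},\{a,d\}$. Isomorphism of labeled digraphs: a node-label-preserving bijection of node sets with edges mapping to edges and non-edges to non-edges, preserving edge labels. The extended line digraph of $G$ is the labeled digraph $\mathcal L(G)=(\mathcal D,\mathcal D_L,\bar\ell_v,\bar\ell_e)$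 with node set $\mathcal D$, node labels $\bar\ell_v((u,v))=(\ell_v(u),\ell_v(v))$, and, for distinct $e=(u,v),\hat e=(\hat u,\hat v)\in\mathcal D$: $(e,\hat e)\in\mathcal D_L$ labeled $ht$ iff $v=\hat u$; $(e,\hat e),(\hat e,e)\in\mathcal D_L$ labeled $tt$ iff $u=\hat u$; $(e,\hat e),(\hat e,e)\in\mathcal D_L$ labeled $hh$ iff $v=\hat v$. -}

module Defs where

open import Data.Nat using (ℕ)
open import Data.Fin using (Fin; zero; suc)
open import Data.Bool using (Bool; true; false; T)
open import Data.Product using (Σ; ∃; ∃-syntax; _×_; _,_; proj₁; proj₂)
open import Data.Sum using (_⊎_)
open import Relation.Nullary using (¬_)
open import Relation.Binary.PropositionalEquality using (_≡_)
open import Function.Bundles using (_⇔_; _↔_; Inverse)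
open import Function.Definitions using (Injective)

-- A finite node-labeled digraph with node set Fin n, edge set given by a
-- Boolean adjacency (so there are never parallel edges with the same source
-- and target), and node labels in L.
record Digraph (L : Set) : Set where
  field
    n   : ℕ
    E   : Fin n → Fin n → Bool
    lab : Fin n → L

open Digraph public

Edge : {L : Set} → Digraph L → Set
Edge G = Σ (Fin (n G) × Fin (n G)) (λ p → T (E G (proj₁ p) (proj₂ p)))

src : {L : Set} (G : Digraph L) → Edge G → Fin (n G)
src G e = proj₁ (proj₁ e)

tgt : {L : Set} (G : Digraph L) → Edge G → Fin (n G)
tgt G e = proj₂ (proj₁ e)

data Reach {L : Set} (G : Digraph L) : Fin (n G) → Fin (n G) → Set where
  here : ∀ {u} → Reach G u u
  fwd  : ∀ {u v w} → E G u v ≡ true → Reach G v w → Reach G u w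
  bwd  : ∀ {u v w} → E G v u ≡ true → Reach G v w → Reach G u w

WeaklyConnected : {L : Set} → Digraph L → Set
WeaklyConnected G = ∀ u v → Reach G u v

-- Simple: no self-loops (parallel edges are excluded by the encoding).
Simple : {L : Set} → Digraph L → Set
Simple G = ∀ u → E G u u ≡ false

Oriented : {L : Set} → Digraph L → Set
Oriented G = ∀ u v → E G u v ≡ true → E G v u ≡ false

record Subgraph {L : Set} (G : Digraph L) : Set where
  field
    U : Fin (n G) → Bool
    W : Edge G → Bool
    closed : ∀ e → W e ≡ true → (U (src G e) ≡ true × U (tgt G e) ≡ true)

open Subgraph public

-- Adjacency of the structure S(K) of a subgraph K of G with node predicate
-- Nd and edge predicate Ed: {x,y} is an edge iff (x,y) or (y,x) is in Ed.
SAdj : {L : Set} (G : Digraph L) → (Edge G → Set) → Fin (n G) → Fin (n G) → Set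
SAdj G Ed x y = ∃[ e ] (Ed e × ((src G e ≡ x × tgt G e ≡ y) ⊎ (src G e ≡ y × tgt G e ≡ x)))

-- The graph Y on nodes a,b,c,d = 0,1,2,3 with edges {a,b},{a,c},{a,d}.
YAdj : Fin 4 → Fin 4 → Set
YAdj i j = (i ≡ zero × ¬ (j ≡ zero)) ⊎ (j ≡ zero × ¬ (i ≡ zero))

-- S(K) ≅ Y, for K with node set {x | Nd x} and edge set {e | Ed e}:
-- an isomorphism Y → S(K), i.e. an injective map f from the nodes of Y
-- onto the node set of K, with edges mapping to edges and non-edges to
-- non-edges.
StructIsoY : {L : Set} (G : Digraph L) → (Fin (n G) → Set) → (Edge G → Set) → Set
StructIsoY G Nd Ed =
  Σ (Fin 4 → Fin (n G)) λ f →
    Injective _≡_ _≡_ f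
    × (∀ x → Nd x ⇔ (∃[ i ] f i ≡ x))
    × (∀ i j → YAdj i j ⇔ SAdj G Ed (f i) (f j))

SubgraphStructIsoY : {L : Set} {G : Digraph L} → Subgraph G → Set
SubgraphStructIsoY {G = G} H = StructIsoY G (λ x → U H x ≡ true) (λ e → W H e ≡ true)

data LEdgeLabel : Set where
  ht tt hh : LEdgeLabel

lineLab : {L : Set} {G : Digraph L} → Edge G → L × L
lineLab {G = G} e = lab G (src G e) , lab G (tgt G e)

LEdge : {L : Set} (G : Digraph L) → LEdgeLabel → Edge G → Edge G → Set
LEdge G ht e ê = ¬ (e ≡ ê) × tgt G e ≡ src G ê
LEdge G tt e ê = ¬ (e ≡ ê) × src G e ≡ src G ê
LEdge G hh e ê = ¬ (e ≡ ê) × tgt G e ≡ tgt G ê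

IsLineIso : {L : Set} (G G' : Digraph L) → (Edge G ↔ Edge G') → Set
IsLineIso G G' φ =
  (∀ e → lineLab {G = G} e ≡ lineLab {G = G'} (Inverse.to φ e))
  × (∀ k e ê → LEdge G k e ê ⇔ LEdge G' k (Inverse.to φ e) (Inverse.to φ ê))

ImageEdges : {L : Set} {G G' : Digraph L} → (Edge G ↔ Edge G') → (Edge G → Bool) → Edge G' → Set
ImageEdges {G = G} φ Wp e' = ∃[ e ] (Wp e ≡ true × Inverse.to φ e ≡ e')

-- Node set of the edge-induced subgraph by an edge set Ed: the endpoints.
EndpointsOf : {L : Set} (G : Digraph L) → (Edge G → Set) → Fin (n G) → Set
EndpointsOf G Ed x = ∃[ e ] (Ed e × (src G e ≡ x ⊎ tgt G e ≡ x))

-- A subgraph whose structure is Y is a claw: three edges sharing a centre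
-- whose other ends are pairwise distinct.  An isomorphism of extended line
-- digraphs preserves, for every pair of distinct edges, which of their ends
-- coincide (the labels tt, hh and ht), so the images of the three edges
-- again share a common end.  In an oriented graph an edge is determined by
-- its unordered pair of ends, so the images' other ends are pairwise
-- distinct, and in a simple graph they differ from the centre: the images
-- form a claw again, whose structure is Y.
module Submission where

open import Defs
open import Data.Bool using (Bool; true; T)
open import Data.Bool.Properties using (T-irrelevant; T-≡)
open import Data.Empty using (⊥; ⊥-elim)
open import Data.Fin using (Fin; zero; suc)
open import Data.Fin.Properties using (suc-injective; 0≢1+n)
open import Data.Product using (∃-syntax; _×_; _,_; proj₁; proj₂)
open import Data.Sum using (_⊎_; inj₁; inj₂; swap; [_,_])
open import Function.Bundles using (_↔_; mk⇔; Inverse; Equivalence; Injection)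
open import Function.Definitions using (Injective)
open import Function.Properties.Inverse using (↔⇒↣)
open import Relation.Binary.PropositionalEquality
  using (_≡_; _≢_; refl; sym; trans; cong; subst; ≢-sym)

data Side : Set where
  tail head : Side

opposite : Side → Side
opposite tail = head
opposite head = tail

side-cases : ∀ s t → t ≡ s ⊎ t ≡ opposite s
side-cases tail tail = inj₁ refl
side-cases tail head = inj₂ refl
side-cases head tail = inj₂ refl
side-cases head head = inj₁ refl

end : {L : Set} (G : Digraph L) → Side → Edge G → Fin (n G)
end G tail = src G
end G head = tgt G

-- Chosen so that SAdj G Ed x y unfolds to ∃[ e ] (Ed e × Joins G e x y).
Joins : {L : Set} (G : Digraph L) → Edge G → Fin (n G) → Fin (n G) → Set
Joins G e x y = (src G e ≡ x × tgt G e ≡ y) ⊎ (src G e ≡ y × tgt G e ≡ x)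

module _ {L : Set} (G : Digraph L) where

  end⇒src⊎tgt : ∀ {x} s {e} → end G s e ≡ x → src G e ≡ x ⊎ tgt G e ≡ x
  end⇒src⊎tgt tail = inj₁
  end⇒src⊎tgt head = inj₂

  opposite-end-unique : ∀ {x} s s' {e} → end G s e ≡ x → end G s' e ≡ x
    → end G (opposite s) e ≡ end G (opposite s') e
  opposite-end-unique tail tail p q = refl
  opposite-end-unique head head p q = refl
  opposite-end-unique tail head p q = trans q (sym p)
  opposite-end-unique head tail p q = trans q (sym p)

  joins-at-side : ∀ {e x y} → Joins G e x y
    → ∃[ s ] (end G s e ≡ x × end G (opposite s) e ≡ y)
  joins-at-side (inj₁ (p , q)) = tail , p , q
  joins-at-side (inj₂ (p , q)) = head , q , p

  at-side-joins : ∀ s {e x y} → end G s e ≡ x → end G (opposite s) e ≡ y → Joins G e x y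
  at-side-joins tail p q = inj₁ (p , q)
  at-side-joins head p q = inj₂ (q , p)

  joins-same-ends : ∀ {e x y x' y'} → Joins G e x y → Joins G e x' y'
    → (x ≡ x' × y ≡ y') ⊎ (x ≡ y' × y ≡ x')
  joins-same-ends (inj₁ (p , q)) (inj₁ (p' , q')) = inj₁ (trans (sym p) p' , trans (sym q) q')
  joins-same-ends (inj₁ (p , q)) (inj₂ (p' , q')) = inj₂ (trans (sym p) p' , trans (sym q) q')
  joins-same-ends (inj₂ (p , q)) (inj₁ (p' , q')) = inj₂ (trans (sym q) q' , trans (sym p) p')
  joins-same-ends (inj₂ (p , q)) (inj₂ (p' , q')) = inj₁ (trans (sym q) q' , trans (sym p) p')

  edge-≡ : ∀ {e e'} → src G e ≡ src G e' → tgt G e ≡ tgt G e' → e ≡ e'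
  edge-≡ {(u , v) , t} {(.u , .v) , t'} refl refl = cong ((u , v) ,_) (T-irrelevant t t')

  ends-distinct : Simple G → ∀ s e → end G s e ≢ end G (opposite s) e
  ends-distinct simple tail ((u , .u) , t) refl = subst T (simple u) t
  ends-distinct simple head ((u , .u) , t) refl = subst T (simple u) t

  antiparallel-absurd : Oriented G → ∀ {e e'} → src G e' ≡ tgt G e → tgt G e' ≡ src G e → ⊥
  antiparallel-absurd oriented {(u , v) , t} {(.v , .u) , t'} refl refl =
    subst T (oriented u v (Equivalence.to T-≡ t)) t'

  joins-unique : Oriented G → ∀ {e e' x y} → Joins G e x y → Joins G e' x y → e ≡ e'
  joins-unique _ (inj₁ (p , q)) (inj₁ (p' , q')) = edge-≡ (trans p (sym p')) (trans q (sym q'))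
  joins-unique _ (inj₂ (p , q)) (inj₂ (p' , q')) = edge-≡ (trans p (sym p')) (trans q (sym q'))
  joins-unique oriented {e} {e'} (inj₁ (p , q)) (inj₂ (p' , q')) =
    ⊥-elim (antiparallel-absurd oriented {e} {e'} (trans p' (sym q)) (trans q' (sym p)))
  joins-unique oriented {e} {e'} (inj₂ (p , q)) (inj₁ (p' , q')) =
    ⊥-elim (antiparallel-absurd oriented {e} {e'} (trans p' (sym q)) (trans q' (sym p)))

module _ {L : Set} {G G' : Digraph L} (φ : Edge G ↔ Edge G') (line : IsLineIso G G' φ) where

  open Inverse φ using (to)

  lineIso-preserves-shared-end : ∀ s s' {e ê} → e ≢ ê → end G s e ≡ end G s' ê
    → end G' s (to e) ≡ end G' s' (to ê)
  lineIso-preserves-shared-end tail tail e≢ê p = proj₂ (Equivalence.to (proj₂ line tt _ _) (e≢ê , p))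
  lineIso-preserves-shared-end head head e≢ê p = proj₂ (Equivalence.to (proj₂ line hh _ _) (e≢ê , p))
  lineIso-preserves-shared-end head tail e≢ê p = proj₂ (Equivalence.to (proj₂ line ht _ _) (e≢ê , p))
  lineIso-preserves-shared-end tail head e≢ê p =
    sym (proj₂ (Equivalence.to (proj₂ line ht _ _) (≢-sym e≢ê , sym p)))

YSpoke : Fin 3 → Fin 4 → Fin 4 → Set
YSpoke k i j = (i ≡ zero × j ≡ suc k) ⊎ (i ≡ suc k × j ≡ zero)

YAdj⇒YSpoke : ∀ {i j} → YAdj i j → ∃[ k ] YSpoke k i j
YAdj⇒YSpoke {zero}  {zero}  (inj₁ (_ , j≢0)) = ⊥-elim (j≢0 refl)
YAdj⇒YSpoke {zero}  {zero}  (inj₂ (_ , i≢0)) = ⊥-elim (i≢0 refl)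
YAdj⇒YSpoke {zero}  {suc k} _                = k , inj₁ (refl , refl)
YAdj⇒YSpoke {suc k} {zero}  _                = k , inj₂ (refl , refl)
YAdj⇒YSpoke {suc _} {suc _} (inj₁ (() , _))
YAdj⇒YSpoke {suc _} {suc _} (inj₂ (() , _))

YSpoke⇒YAdj : ∀ {k i j} → YSpoke k i j → YAdj i j
YSpoke⇒YAdj (inj₁ (refl , refl)) = inj₁ (refl , λ ())
YSpoke⇒YAdj (inj₂ (refl , refl)) = inj₂ (refl , λ ())

record Claw {L : Set} (G : Digraph L) (Ed : Edge G → Set) : Set where
  field
    centre          : Fin (n G)
    spoke           : Fin 3 → Edge G
    side            : Fin 3 → Side
    spoke-at-centre : ∀ k → end G (side k) (spoke k) ≡ centre
    leaf-injective  : Injective _≡_ _≡_ (λ k → end G (opposite (side k)) (spoke k))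
    spoke-∈         : ∀ k → Ed (spoke k)
    ∈-spoke         : ∀ e → Ed e → ∃[ k ] e ≡ spoke k

  leaf : Fin 3 → Fin (n G)
  leaf k = end G (opposite (side k)) (spoke k)

  spoke-joins : ∀ k → Joins G (spoke k) centre (leaf k)
  spoke-joins k = at-side-joins G (side k) (spoke-at-centre k) refl

  spoke-injective : Injective _≡_ _≡_ spoke
  spoke-injective {k} {l} eq = leaf-injective (trans
    (opposite-end-unique G (side k) (side l) (spoke-at-centre k)
      (subst (λ e → end G (side l) e ≡ centre) (sym eq) (spoke-at-centre l)))
    (cong (end G (opposite (side l))) eq))

  spoke-ends : ∀ k t → end G t (spoke k) ≡ centre ⊎ end G t (spoke k) ≡ leaf k
  spoke-ends k t with side-cases (side k) t
  ... | inj₁ refl = inj₁ (spoke-at-centre k)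
  ... | inj₂ refl = inj₂ refl

  node : Fin 4 → Fin (n G)
  node zero    = centre
  node (suc k) = leaf k

  node-injective : Simple G → Injective _≡_ _≡_ node
  node-injective simple {zero}  {zero}  _  = refl
  node-injective simple {zero}  {suc l} eq = ⊥-elim (ends-distinct G simple (side l) (spoke l)
                                               (trans (spoke-at-centre l) eq))
  node-injective simple {suc k} {zero}  eq = ⊥-elim (ends-distinct G simple (side k) (spoke k)
                                               (trans (spoke-at-centre k) (sym eq)))
  node-injective simple {suc k} {suc l} eq = cong suc (leaf-injective eq)

module _ {L : Set} {G : Digraph L} {Ed : Edge G → Set} (simple : Simple G) (c : Claw G Ed) where

  open Claw c

  endpoint⇒node : ∀ x → EndpointsOf G Ed x → ∃[ i ] node i ≡ x
  endpoint⇒node x (e , e∈ , src⊎tgt) with ∈-spoke e e∈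
  ... | k , refl = [ node-at tail , node-at head ] src⊎tgt
    where
    node-at : ∀ t → end G t (spoke k) ≡ x → ∃[ i ] node i ≡ x
    node-at t p = [ (λ q → zero , trans (sym q) p) , (λ q → suc k , trans (sym q) p) ] (spoke-ends k t)

  node⇒endpoint : ∀ x → ∃[ i ] node i ≡ x → EndpointsOf G Ed x
  node⇒endpoint _ (zero , refl) =
    spoke zero , spoke-∈ zero , end⇒src⊎tgt G (side zero) (spoke-at-centre zero)
  node⇒endpoint _ (suc k , refl) =
    spoke k , spoke-∈ k , end⇒src⊎tgt G (opposite (side k)) refl

  YAdj⇒SAdj : ∀ i j → YAdj i j → SAdj G Ed (node i) (node j)
  YAdj⇒SAdj i j adj with YAdj⇒YSpoke adj
  ... | k , inj₁ (refl , refl) = spoke k , spoke-∈ k , spoke-joins k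
  ... | k , inj₂ (refl , refl) = spoke k , spoke-∈ k , swap (spoke-joins k)

  SAdj⇒YAdj : ∀ i j → SAdj G Ed (node i) (node j) → YAdj i j
  SAdj⇒YAdj i j (e , e∈ , joins) with ∈-spoke e e∈
  ... | k , refl with joins-same-ends G {spoke k} {centre} {leaf k} {node i} {node j} (spoke-joins k) joins
  ... | inj₁ (p , q) = YSpoke⇒YAdj {k} (inj₁ (sym (node-injective simple {zero} p)
                                             , sym (node-injective simple {suc k} q)))
  ... | inj₂ (p , q) = YSpoke⇒YAdj {k} (inj₂ (sym (node-injective simple {suc k} q)
                                             , sym (node-injective simple {zero} p)))

  claw⇒StructIsoY : StructIsoY G (EndpointsOf G Ed) Ed
  claw⇒StructIsoY = node , node-injective simple
    , (λ x → mk⇔ (endpoint⇒node x) (node⇒endpoint x))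
    , (λ i j → mk⇔ (YAdj⇒SAdj i j) (SAdj⇒YAdj i j))

module _ {L : Set} {G : Digraph L} {Nd : Fin (n G) → Set} {Ed : Edge G → Set}
         (oriented : Oriented G) (closed : ∀ e → Ed e → Nd (src G e) × Nd (tgt G e)) where

  StructIsoY⇒claw : StructIsoY G Nd Ed → Claw G Ed
  StructIsoY⇒claw (f , f-injective , nodes , adjacent) = record
    { centre          = f zero
    ; spoke           = spoke
    ; side            = side
    ; spoke-at-centre = at-centre
    ; leaf-injective  = λ eq → suc-injective (f-injective (trans (sym (at-leaf _)) (trans eq (at-leaf _))))
    ; spoke-∈         = λ k → proj₁ (proj₂ (spoke-adj k))
    ; ∈-spoke         = ∈-spoke
    }
    where
    spoke-adj : ∀ k → SAdj G Ed (f zero) (f (suc k))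
    spoke-adj k = Equivalence.to (adjacent zero (suc k)) (YSpoke⇒YAdj {k} (inj₁ (refl , refl)))

    spoke : Fin 3 → Edge G
    spoke k = proj₁ (spoke-adj k)

    spoke-joins : ∀ k → Joins G (spoke k) (f zero) (f (suc k))
    spoke-joins k = proj₂ (proj₂ (spoke-adj k))

    side : Fin 3 → Side
    side k = proj₁ (joins-at-side G (spoke-joins k))

    at-centre : ∀ k → end G (side k) (spoke k) ≡ f zero
    at-centre k = proj₁ (proj₂ (joins-at-side G (spoke-joins k)))

    at-leaf : ∀ k → end G (opposite (side k)) (spoke k) ≡ f (suc k)
    at-leaf k = proj₂ (proj₂ (joins-at-side G (spoke-joins k)))

    joins-along : ∀ {e i j} k → YSpoke k i j → Joins G e (f i) (f j) → Joins G e (f zero) (f (suc k))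
    joins-along _ (inj₁ (refl , refl)) joins = joins
    joins-along _ (inj₂ (refl , refl)) joins = swap joins

    ∈-spoke : ∀ e → Ed e → ∃[ k ] e ≡ spoke k
    ∈-spoke e e∈ with Equivalence.to (nodes _) (proj₁ (closed e e∈))
                    | Equivalence.to (nodes _) (proj₂ (closed e e∈))
    ... | i , refl | j , refl with YAdj⇒YSpoke (Equivalence.from (adjacent i j) (e , e∈ , inj₁ (refl , refl)))
    ... | k , ij-spoke = k , joins-unique G oriented {e} {spoke k} {f zero} {f (suc k)}
            (joins-along {e} {i} {j} k ij-spoke (inj₁ (refl , refl))) (spoke-joins k)

module _ {L : Set} {G G' : Digraph L} (φ : Edge G ↔ Edge G') (line : IsLineIso G G' φ)
         (oriented' : Oriented G') {Wp : Edge G → Bool} (c : Claw G (λ e → Wp e ≡ true)) where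

  open Inverse φ using (to)
  open Claw c

  private
    centre' : Fin (n G')
    centre' = end G' (side zero) (to (spoke zero))

    at-centre' : ∀ k → end G' (side k) (to (spoke k)) ≡ centre'
    at-centre' zero    = refl
    at-centre' (suc k) = lineIso-preserves-shared-end φ line (side (suc k)) (side zero)
      (λ eq → 0≢1+n (sym (spoke-injective eq)))
      (trans (spoke-at-centre (suc k)) (sym (spoke-at-centre zero)))

    leaf' : Fin 3 → Fin (n G')
    leaf' k = end G' (opposite (side k)) (to (spoke k))

    spoke-joins' : ∀ k → Joins G' (to (spoke k)) centre' (leaf' k)
    spoke-joins' k = at-side-joins G' (side k) (at-centre' k) refl

    leaf-injective' : Injective _≡_ _≡_ leaf'
    leaf-injective' {k} {l} eq = spoke-injective (Injection.injective (↔⇒↣ φ)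
      (joins-unique G' oriented' {to (spoke k)} {to (spoke l)} {centre'} {leaf' l}
        (subst (Joins G' (to (spoke k)) centre') eq (spoke-joins' k)) (spoke-joins' l)))

  lineIso-maps-claw : Claw G' (ImageEdges {G = G} {G' = G'} φ Wp)
  lineIso-maps-claw = record
    { centre          = centre'
    ; spoke           = λ k → to (spoke k)
    ; side            = side
    ; spoke-at-centre = at-centre'
    ; leaf-injective  = leaf-injective'
    ; spoke-∈         = λ k → spoke k , spoke-∈ k , refl
    ; ∈-spoke         = λ { _ (e , e∈ , refl) → proj₁ (∈-spoke e e∈) , cong to (proj₂ (∈-spoke e e∈)) }
    }

corollaryA5 : {L : Set} (G G' : Digraph L)
    → WeaklyConnected G → Simple G → Oriented G
    → WeaklyConnected G' → Simple G' → Oriented G'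
    → (H : Subgraph G) → SubgraphStructIsoY H
    → (φ : Edge G ↔ Edge G') → IsLineIso G G' φ
    → StructIsoY G' (EndpointsOf G' (ImageEdges {G = G} {G' = G'} φ (W H)))
    (ImageEdges {G = G} {G' = G'} φ (W H))
corollaryA5 G G' _ _ oriented _ simple' oriented' H S[H]≅Y φ line =
  claw⇒StructIsoY simple' (lineIso-maps-claw φ line oriented' (StructIsoY⇒claw oriented (closed H) S[H]≅Y))
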